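{- For any integer $1\leq p\leq \binom{n}{2}$, there exist an undirected weighted graph $G$ on $\Theta(n)$ nodes and a set $P$ of $p$ node pairs such that every $1$-FT $P$-pairwise preserver of $G$ contains $\Omega(\min(np,n^2))$ edges.
   Context: A subgraph $H\subseteq G=(V,E)$ is a $1$-FT $P$-pairwise preserver if $\mathrm{dist}_{H\setminus F}(s,t)=\mathrm{dist}_{G\setminus F}(s,t)$ for every $(s,t)\in P$ and every $F\subseteq E$ with $|F|\leq 1$. Here $n$ denotes (up to a constant factor) the number of nodes of the graph. -}

module Defs where

open import Data.Nat using (ℕ; zero; suc; _+_; _*_; _≤_; _<_)
open import Data.Fin using (Fin)
open import Data.Fin.Subset using (Subset; _∈_; _⊆_; _∩_; ∁; ∣_∣)
open import Data.Product using (Σ; _×_; _,_; proj₁; proj₂)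
open import Data.Sum using (_⊎_)
open import Data.Maybe using (Maybe; just; nothing)
open import Data.Vec using (Vec; lookup)
open import Relation.Nullary using (¬_)
open import Relation.Binary.PropositionalEquality using (_≡_; _≢_)
open import Function.Bundles using (_⇔_)

SamePair : ∀ {N} → (Fin N × Fin N) → (Fin N × Fin N) → Set
SamePair (a , b) (c , d) = (a ≡ c × b ≡ d) ⊎ (a ≡ d × b ≡ c)

record WGraph : Set where
  field
    N       : ℕ
    m       : ℕ
    ends    : Fin m → Fin N × Fin N
    weight  : Fin m → ℕ
    noLoop  : ∀ e → proj₁ (ends e) ≢ proj₂ (ends e)
    simple  : ∀ e f → SamePair (ends e) (ends f) → e ≡ f
    wpos    : ∀ e → 1 ≤ weight e
open WGraph public

EdgeSet : WGraph → Set
EdgeSet G = Subset (m G)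

data Walk (G : WGraph) (S : EdgeSet G) : Fin (N G) → Fin (N G) → ℕ → Set where
  nil  : ∀ {v} → Walk G S v v 0
  cons : ∀ {u v w k} (e : Fin (m G)) → e ∈ S → SamePair (ends G e) (u , v) →
         Walk G S v w k → Walk G S u w (weight G e + k)

-- IsDist G S s t d : the distance from s to t in (V, S) is d
-- (just d = finite distance d, nothing = t unreachable from s, i.e. ∞).
IsDist : (G : WGraph) → EdgeSet G → Fin (N G) → Fin (N G) → Maybe ℕ → Set
IsDist G S s t (just d) = Walk G S s t d × (∀ k → Walk G S s t k → d ≤ k)
IsDist G S s t nothing  = ∀ k → ¬ Walk G S s t k

SameDist : (G : WGraph) → EdgeSet G → EdgeSet G → Fin (N G) → Fin (N G) → Set
SameDist G S T s t = ∀ d → IsDist G S s t d ⇔ IsDist G T s t d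

AllEdges : (G : WGraph) → EdgeSet G
AllEdges G = Data.Fin.Subset.⊤

OneFTPreserver : (G : WGraph) {p : ℕ} → Vec (Fin (N G) × Fin (N G)) p → EdgeSet G → Set
OneFTPreserver G {p} P H =
  ∀ (i : Fin p) (F : EdgeSet G) → ∣ F ∣ ≤ 1 →
    SameDist G (H ∩ ∁ F) (AllEdges G ∩ ∁ F) (proj₁ (lookup P i)) (proj₂ (lookup P i))

PairSet : (G : WGraph) {p : ℕ} → Vec (Fin (N G) × Fin (N G)) p → Set
PairSet G {p} P =
  (∀ i → proj₁ (lookup P i) ≢ proj₂ (lookup P i)) ×
  (∀ i j → SamePair (lookup P i) (lookup P j) → i ≡ j)

module Submission where

-- The graph is a unit-weight path P₀ — P₁ — ⋯ — Pₙ with source Pₙ, plus n leaves Xₜ, each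
-- joined to every P₍ⱼ₊₁₎ by an edge of weight 2j + 3; the first min(p, n) pairs are (Pₙ, Xₜ).
-- If the segment Pⱼ — P₍ⱼ₊₁₎ fails, the shortest Pₙ–Xₜ walk descends to P₍ⱼ₊₁₎ and takes the
-- edge (j, t), for a length of n + j + 2. Lower bounds on walk lengths come from potentials φ
-- with |φ x − φ y| ≤ w(xy) on every available edge: φ vanishes on P₀ … Pⱼ, is k + j + 3 on Pₖ
-- above the failure, and is 1 on the leaves — except on Xₜ when the edge (j, t) is missing,
-- where it can be 0, raising the bound to n + j + 3. So a 1-FT preserver keeps every edge
-- (j, t) with t < min(p, n), that is n · min(p, n) edges.

open import Defs
open import Data.Nat using (ℕ; zero; suc; _+_; _*_; _≤_; _<_; _⊓_; z≤n; s≤s; _<?_; _≤?_)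
open import Data.Nat.Properties
open import Data.Nat.Combinatorics using (_C_; nC1≡n; nCk+nC[k+1]≡[n+1]C[k+1])
open import Data.Fin using (Fin; zero; suc; toℕ; fromℕ; fromℕ<; inject₁; inject≤; _↑ˡ_; _↑ʳ_; splitAt; join; combine; remQuot; quotient; remainder; opposite)
open import Data.Fin.Properties as Finₚ using (toℕ-injective; toℕ-inject₁; toℕ<n; toℕ-fromℕ; toℕ-fromℕ<; toℕ-inject≤; toℕ-↑ˡ; inject₁-injective; inject≤-injective; ↑ˡ-injective; ↑ʳ-injective; splitAt-↑ˡ; splitAt-↑ʳ; join-splitAt; remQuot-combine; combine-remQuot; opposite-involutive)
open import Data.Fin.Induction using (<-weakInduction)
open import Data.Fin.Subset using (Subset; _∈_; _∉_; _∩_; ∁; ⁅_⁆; _-_; ∣_∣; ⊤)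
open import Data.Fin.Subset.Properties using (_∈?_; ∈⊤; x∈⁅x⁆; x∈⁅y⁆⇒x≡y; x∈p∩q⁺; x∈p∩q⁻; x∈∁p⇒x∉p; x∉p⇒x∈∁p; x∈p∧x∉q⇒x∈p─q; x∈p⇒∣p-x∣<∣p∣; ∣⁅x⁆∣≡1)
open import Data.Maybe using (just)
open import Data.Product using (Σ; _×_; _,_; proj₁; proj₂; uncurry)
open import Data.Sum using (_⊎_; inj₁; inj₂; [_,_]′)
open import Data.Sum.Properties using (inj₁-injective; inj₂-injective)
import Data.Sum as Sum
open import Data.Vec using (Vec; lookup; tabulate)
open import Data.Vec.Properties using (lookup∘tabulate)
open import Function using (_∘_)
open import Function.Bundles using (Equivalence)
open import Function.Definitions using (Injective)
open import Relation.Binary.Definitions using (tri<; tri≈; tri>)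
open import Relation.Binary.PropositionalEquality using (_≡_; _≢_; refl; sym; trans; cong; cong₂; subst; subst₂; module ≡-Reasoning)
open import Relation.Nullary using (yes; no)
open import Data.Empty using (⊥-elim)

injection⇒≤∣p∣ : ∀ {m n} (p : Subset n) (f : Fin m → Fin n) →
                 Injective _≡_ _≡_ f → (∀ i → f i ∈ p) → m ≤ ∣ p ∣
injection⇒≤∣p∣ {zero}  p f f-inj f∈p = z≤n
injection⇒≤∣p∣ {suc m} p f f-inj f∈p =
  ≤-trans (s≤s (injection⇒≤∣p∣ (p - f zero) (f ∘ suc) (Finₚ.suc-injective ∘ f-inj) f∘suc∈p-f₀))
          (x∈p⇒∣p-x∣<∣p∣ (f∈p zero))
  where
  f∘suc∈p-f₀ : ∀ i → f (suc i) ∈ p - f zero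
  f∘suc∈p-f₀ i = x∈p∧x∉q⇒x∈p─q (f∈p (suc i))
                   (λ fᵢ∈⁅f₀⁆ → Finₚ.0≢1+n (f-inj (sym (x∈⁅y⁆⇒x≡y _ fᵢ∈⁅f₀⁆))))

x∉p∩∁⁅x⁆ : ∀ {n} (p : Subset n) (x : Fin n) → x ∉ p ∩ ∁ ⁅ x ⁆
x∉p∩∁⁅x⁆ p x x∈ = x∈∁p⇒x∉p (proj₂ (x∈p∩q⁻ p _ x∈)) (x∈⁅x⁆ x)

x∈p∩∁⁅y⁆ : ∀ {n} {p : Subset n} {x y : Fin n} → x ∈ p → x ≢ y → x ∈ p ∩ ∁ ⁅ y ⁆
x∈p∩∁⁅y⁆ x∈p x≢y = x∈p∩q⁺ (x∈p , x∉p⇒x∈∁p (x≢y ∘ x∈⁅y⁆⇒x≡y _))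

remQuot-injective : ∀ {m} n → Injective _≡_ _≡_ (remQuot {m} n)
remQuot-injective {m} n {a} {b} eq =
  trans (sym (combine-remQuot {m} n a)) (trans (cong (uncurry combine) eq) (combine-remQuot {m} n b))

opposite-injective : ∀ {n} → Injective _≡_ _≡_ (opposite {n})
opposite-injective {_} {a} {b} eq =
  trans (sym (opposite-involutive a)) (trans (cong opposite eq) (opposite-involutive b))

nC2≤n*n : ∀ n → n C 2 ≤ n * n
nC2≤n*n zero    = z≤n
nC2≤n*n (suc n) = begin
  suc n C 2       ≡⟨ nCk+nC[k+1]≡[n+1]C[k+1] n 1 ⟨
  n C 1 + n C 2   ≤⟨ +-mono-≤ (≤-reflexive (nC1≡n n)) (nC2≤n*n n) ⟩
  n + n * n       ≤⟨ *-monoʳ-≤ (suc n) (n≤1+n n) ⟩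
  suc n * suc n   ∎
  where open ≤-Reasoning

1≤nC2⇒1≤n : ∀ {n} → 1 ≤ n C 2 → 1 ≤ n
1≤nC2⇒1≤n {suc n} _ = s≤s z≤n

module _ (G : WGraph) where

  FeasiblePotential : EdgeSet G → (Fin (N G) → ℕ) → Set
  FeasiblePotential S φ = ∀ e → e ∈ S →
    (φ (proj₁ (ends G e)) ≤ weight G e + φ (proj₂ (ends G e))) ×
    (φ (proj₂ (ends G e)) ≤ weight G e + φ (proj₁ (ends G e)))

  potential≤length : ∀ {S φ u w k} → FeasiblePotential S φ → Walk G S u w k → φ u ≤ k + φ w
  potential≤length feasible nil = ≤-refl
  potential≤length {φ = φ} feasible (cons {v = v} {w = w} {k = k} e e∈S joins W) = begin
    φ _                     ≤⟨ across joins ⟩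
    weight G e + φ v        ≤⟨ +-monoʳ-≤ (weight G e) (potential≤length feasible W) ⟩
    weight G e + (k + φ w)  ≡⟨ +-assoc (weight G e) k (φ w) ⟨
    weight G e + k + φ w    ∎
    where
    open ≤-Reasoning
    across : ∀ {u} → SamePair (ends G e) (u , v) → φ u ≤ weight G e + φ v
    across (inj₁ (refl , refl)) = proj₁ (feasible e e∈S)
    across (inj₂ (refl , refl)) = proj₂ (feasible e e∈S)

-- The potential of Pₖ when the segment P_J — P₍J₊₁₎ has failed.
height : ℕ → ℕ → ℕ
height J k with J <? k
... | yes _ = 3 + (k + J)
... | no  _ = 0

height-low : ∀ {J k} → k ≤ J → height J k ≡ 0
height-low {J} {k} k≤J with J <? k
... | yes J<k = ⊥-elim (<⇒≱ J<k k≤J)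
... | no  _   = refl

height-high : ∀ {J k} → J < k → height J k ≡ 3 + (k + J)
height-high {J} {k} J<k with J <? k
... | yes _   = refl
... | no  J≮k = ⊥-elim (J≮k J<k)

height-step : ∀ J k → k ≢ J → (height J k ≤ 1 + height J (suc k)) × (height J (suc k) ≤ 1 + height J k)
height-step J k k≢J with <-cmp k J
... | tri< k<J _ _ rewrite height-low (<⇒≤ k<J) | height-low k<J = z≤n , z≤n
... | tri≈ _ k≡J _ = ⊥-elim (k≢J k≡J)
... | tri> _ _ J<k rewrite height-high J<k | height-high (m<n⇒m<1+n J<k) =
  m≤n+m _ 2 , ≤-refl

height-cross : ∀ J Q ℓ → (Q ≡ J → 1 ≤ ℓ) → height J (suc Q) ≤ 3 + (Q + Q) + ℓ
height-cross J Q ℓ Q≡J⇒1≤ℓ with suc Q ≤? J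
... | yes Q<J rewrite height-low Q<J = z≤n
... | no  Q≮J rewrite height-high (≰⇒> Q≮J) with m≤n⇒m<n∨m≡n (≤-pred (≰⇒> Q≮J))
...   | inj₁ J<Q = begin
  3 + (suc Q + J)  ≡⟨ cong (3 +_) (+-suc Q J) ⟨
  3 + (Q + suc J)  ≤⟨ +-monoʳ-≤ 3 (+-monoʳ-≤ Q J<Q) ⟩
  3 + (Q + Q)      ≤⟨ m≤m+n _ ℓ ⟩
  3 + (Q + Q) + ℓ  ∎
  where open ≤-Reasoning
...   | inj₂ refl = begin
  suc (3 + (J + J))  ≡⟨ +-comm 1 (3 + (J + J)) ⟩
  3 + (J + J) + 1    ≤⟨ +-monoʳ-≤ (3 + (J + J)) (Q≡J⇒1≤ℓ refl) ⟩
  3 + (J + J) + ℓ    ∎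
  where open ≤-Reasoning

module Construction (n : ℕ) where

  V : ℕ
  V = suc n + n

  path : Fin (suc n) → Fin V
  path a = a ↑ˡ n

  leaf : Fin n → Fin V
  leaf t = suc n ↑ʳ t

  source : Fin V
  source = path (fromℕ n)

  path-injective : ∀ {a b} → path a ≡ path b → a ≡ b
  path-injective = ↑ˡ-injective n _ _

  leaf-injective : ∀ {s t} → leaf s ≡ leaf t → s ≡ t
  leaf-injective = ↑ʳ-injective (suc n) _ _

  path≢leaf : ∀ {a t} → path a ≢ leaf t
  path≢leaf {a} {t} eq
    with () ← trans (sym (splitAt-↑ˡ (suc n) a n)) (trans (cong (splitAt (suc n)) eq) (splitAt-↑ʳ (suc n) n t))

  -- inj₁ i is the segment Pᵢ — P₍ᵢ₊₁₎ and inj₂ (j , t) the edge P₍ⱼ₊₁₎ — Xₜ.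
  Edge : Set
  Edge = Fin n ⊎ Fin n × Fin n

  E : ℕ
  E = n + n * n

  encode : Edge → Fin E
  encode = join n (n * n) ∘ Sum.map₂ (uncurry combine)

  decode : Fin E → Edge
  decode = Sum.map₂ (remQuot n) ∘ splitAt n

  decode-encode : ∀ x → decode (encode x) ≡ x
  decode-encode (inj₁ i)       = cong (Sum.map₂ (remQuot n)) (splitAt-↑ˡ n i (n * n))
  decode-encode (inj₂ (j , t)) = trans (cong (Sum.map₂ (remQuot n)) (splitAt-↑ʳ n (n * n) (combine j t)))
                                       (cong inj₂ (remQuot-combine j t))

  encode-decode : ∀ e → encode (decode e) ≡ e
  encode-decode e with splitAt n e | join-splitAt n (n * n) e
  ... | inj₁ i | eq = eq
  ... | inj₂ c | eq = trans (cong (n ↑ʳ_) (combine-remQuot {n} n c)) eq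

  encode-injective : ∀ x y → encode x ≡ encode y → x ≡ y
  encode-injective x y eq = trans (sym (decode-encode x)) (trans (cong decode eq) (decode-encode y))

  decode-injective : ∀ {e f} → decode e ≡ decode f → e ≡ f
  decode-injective {e} {f} eq = trans (sym (encode-decode e)) (trans (cong encode eq) (encode-decode f))

  segment : Fin n → Fin E
  segment i = encode (inj₁ i)

  cross : Fin n → Fin n → Fin E
  cross j t = encode (inj₂ (j , t))

  data EdgeView : Fin E → Set where
    is-segment : ∀ i → EdgeView (segment i)
    is-cross   : ∀ j t → EdgeView (cross j t)

  edgeView : ∀ e → EdgeView e
  edgeView e = subst EdgeView (encode-decode e) (view (decode e))
    where
    view : ∀ x → EdgeView (encode x)
    view (inj₁ i)       = is-segment i
    view (inj₂ (j , t)) = is-cross j t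

  endpoints : Edge → Fin V × Fin V
  endpoints (inj₁ i)       = path (inject₁ i) , path (suc i)
  endpoints (inj₂ (j , t)) = path (suc j) , leaf t

  length : Edge → ℕ
  length (inj₁ i)       = 1
  length (inj₂ (j , t)) = 3 + (toℕ j + toℕ j)

  endpoints-injective : ∀ x y → SamePair (endpoints x) (endpoints y) → x ≡ y
  endpoints-injective (inj₁ i) (inj₁ i′) (inj₁ (eq , _)) = cong inj₁ (inject₁-injective (path-injective eq))
  endpoints-injective (inj₁ i) (inj₁ i′) (inj₂ (eq₁ , eq₂)) = ⊥-elim (<-asym i′<i i<i′)
    where
    i′<i : toℕ i′ < toℕ i
    i′<i = subst (toℕ i′ <_) (trans (cong toℕ (sym (path-injective eq₁))) (toℕ-inject₁ i)) ≤-refl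
    i<i′ : toℕ i < toℕ i′
    i<i′ = subst (toℕ i <_) (trans (cong toℕ (path-injective eq₂)) (toℕ-inject₁ i′)) ≤-refl
  endpoints-injective (inj₁ _) (inj₂ _) (inj₁ (_ , eq)) = ⊥-elim (path≢leaf eq)
  endpoints-injective (inj₁ _) (inj₂ _) (inj₂ (eq , _)) = ⊥-elim (path≢leaf eq)
  endpoints-injective (inj₂ _) (inj₁ _) (inj₁ (_ , eq)) = ⊥-elim (path≢leaf (sym eq))
  endpoints-injective (inj₂ _) (inj₁ _) (inj₂ (_ , eq)) = ⊥-elim (path≢leaf (sym eq))
  endpoints-injective (inj₂ _) (inj₂ _) (inj₁ (eq₁ , eq₂)) =
    cong inj₂ (cong₂ _,_ (Finₚ.suc-injective (path-injective eq₁)) (leaf-injective eq₂))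
  endpoints-injective (inj₂ _) (inj₂ _) (inj₂ (eq , _)) = ⊥-elim (path≢leaf eq)

  G : WGraph
  G = record
    { N      = V
    ; m      = E
    ; ends   = endpoints ∘ decode
    ; weight = length ∘ decode
    ; noLoop = λ e eq → not-loop (decode e) eq
    ; simple = λ e f joins → decode-injective (endpoints-injective (decode e) (decode f) joins)
    ; wpos   = positive ∘ decode
    }
    where
    not-loop : ∀ x → proj₁ (endpoints x) ≢ proj₂ (endpoints x)
    not-loop (inj₁ i) eq = <-irrefl (trans (sym (toℕ-inject₁ i)) (cong toℕ (path-injective eq))) ≤-refl
    not-loop (inj₂ _) eq = path≢leaf eq
    positive : ∀ x → 1 ≤ length x
    positive (inj₁ _) = ≤-refl
    positive (inj₂ _) = s≤s z≤n

  ends-segment : ∀ i → SamePair (ends G (segment i)) (path (suc i) , path (inject₁ i))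
  ends-segment i rewrite decode-encode (inj₁ i) = inj₂ (refl , refl)

  ends-cross : ∀ j t → SamePair (ends G (cross j t)) (path (suc j) , leaf t)
  ends-cross j t rewrite decode-encode (inj₂ (j , t)) = inj₁ (refl , refl)

  weight-segment : ∀ i → weight G (segment i) ≡ 1
  weight-segment i = cong length (decode-encode (inj₁ i))

  weight-cross : ∀ j t → weight G (cross j t) ≡ 3 + (toℕ j + toℕ j)
  weight-cross j t = cong length (decode-encode (inj₂ (j , t)))

  cross≢segment : ∀ {j t i} → cross j t ≢ segment i
  cross≢segment {j} {t} {i} eq with () ← encode-injective (inj₂ (j , t)) (inj₁ i) eq

  cross-injective : ∀ {j t j′ t′} → cross j t ≡ cross j′ t′ → (j , t) ≡ (j′ , t′)
  cross-injective eq = inj₂-injective (encode-injective (inj₂ _) (inj₂ _) eq)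

  leafLevel : EdgeSet G → Fin n → Fin n → ℕ
  leafLevel S j s with cross j s ∈? S
  ... | yes _ = 1
  ... | no  _ = 0

  leafLevel≤1 : ∀ S j s → leafLevel S j s ≤ 1
  leafLevel≤1 S j s with cross j s ∈? S
  ... | yes _ = ≤-refl
  ... | no  _ = z≤n

  leafLevel-∈ : ∀ {S j s} → cross j s ∈ S → leafLevel S j s ≡ 1
  leafLevel-∈ {S} {j} {s} c∈S with cross j s ∈? S
  ... | yes _   = refl
  ... | no  c∉S = ⊥-elim (c∉S c∈S)

  leafLevel-∉ : ∀ {S j s} → cross j s ∉ S → leafLevel S j s ≡ 0
  leafLevel-∉ {S} {j} {s} c∉S with cross j s ∈? S
  ... | yes c∈S = ⊥-elim (c∉S c∈S)
  ... | no  _   = refl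

  potential : EdgeSet G → Fin n → Fin V → ℕ
  potential S j = [ height (toℕ j) ∘ toℕ , leafLevel S j ]′ ∘ splitAt (suc n)

  potential-path : ∀ S j a → potential S j (path a) ≡ height (toℕ j) (toℕ a)
  potential-path S j a rewrite splitAt-↑ˡ (suc n) a n = refl

  potential-leaf : ∀ S j s → potential S j (leaf s) ≡ leafLevel S j s
  potential-leaf S j s rewrite splitAt-↑ʳ (suc n) n s = refl

  potential-feasible : ∀ {S} j → segment j ∉ S → FeasiblePotential G S (potential S j)
  potential-feasible {S} j j∉S e e∈S with edgeView e
  ... | is-segment i
    rewrite decode-encode (inj₁ i) | potential-path S j (inject₁ i) | potential-path S j (suc i) | toℕ-inject₁ i =
    height-step (toℕ j) (toℕ i) (λ i≡j → j∉S (subst (_∈ S) (cong segment (toℕ-injective i≡j)) e∈S))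
  ... | is-cross q s
    rewrite decode-encode (inj₂ (q , s)) | potential-path S j (suc q) | potential-leaf S j s =
    height-cross (toℕ j) (toℕ q) (leafLevel S j s)
      (λ q≡j → ≤-reflexive (sym (leafLevel-∈ (subst (λ x → cross x s ∈ S) (toℕ-injective q≡j) e∈S)))) ,
    ≤-trans (leafLevel≤1 S j s) (s≤s z≤n)

  detour-lower-bound : ∀ {S j t k} → segment j ∉ S → Walk G S source (leaf t) k →
                       3 + (n + toℕ j) ≤ k + leafLevel S j t
  detour-lower-bound {S} {j} {t} {k} j∉S W = begin
    3 + (n + toℕ j)              ≡⟨ cong (λ a → 3 + (a + toℕ j)) (toℕ-fromℕ n) ⟨
    3 + (toℕ (fromℕ n) + toℕ j)  ≡⟨ height-high (subst (toℕ j <_) (sym (toℕ-fromℕ n)) (toℕ<n j)) ⟨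
    height (toℕ j) (toℕ (fromℕ n)) ≡⟨ potential-path S j (fromℕ n) ⟨
    potential S j source         ≤⟨ potential≤length G {φ = potential S j} (potential-feasible j j∉S) W ⟩
    k + potential S j (leaf t)   ≡⟨ cong (k +_) (potential-leaf S j t) ⟩
    k + leafLevel S j t          ∎
    where open ≤-Reasoning

  detour : ∀ {S} j t → (∀ e → e ≢ segment j → e ∈ S) → Walk G S source (leaf t) (2 + (n + toℕ j))
  detour {S} j t others∈S =
    subst (Walk G S source (leaf t)) (cong (λ a → 2 + (a + toℕ j)) (toℕ-fromℕ n))
      (<-weakInduction Reach (λ ()) descend (fromℕ n) (subst (toℕ j <_) (sym (toℕ-fromℕ n)) (toℕ<n j)))
    where
    Reach : Fin (suc n) → Set
    Reach a = toℕ j < toℕ a → Walk G S (path a) (leaf t) (2 + (toℕ a + toℕ j))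

    descend : ∀ i → Reach (inject₁ i) → Reach (suc i)
    descend i reach j<1+i with m≤n⇒m<n∨m≡n (≤-pred j<1+i)
    ... | inj₁ j<i = subst (Walk G S (path (suc i)) (leaf t)) walk-length
      (cons (segment i) (others∈S _ i≢j) (ends-segment i) (reach (subst (toℕ j <_) (sym (toℕ-inject₁ i)) j<i)))
      where
      i≢j : segment i ≢ segment j
      i≢j eq = <-irrefl (cong toℕ (sym (inj₁-injective (encode-injective (inj₁ i) (inj₁ j) eq)))) j<i
      walk-length : weight G (segment i) + (2 + (toℕ (inject₁ i) + toℕ j)) ≡ 2 + (suc (toℕ i) + toℕ j)
      walk-length rewrite weight-segment i | toℕ-inject₁ i = refl
    ... | inj₂ j≡i with refl ← toℕ-injective j≡i = subst (Walk G S (path (suc j)) (leaf t)) walk-length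
      (cons (cross j t) (others∈S _ cross≢segment) (ends-cross j t) nil)
      where
      walk-length : weight G (cross j t) + 0 ≡ 2 + (suc (toℕ j) + toℕ j)
      walk-length rewrite weight-cross j t = +-identityʳ _

  detour-distance : ∀ j t → IsDist G (⊤ ∩ ∁ ⁅ segment j ⁆) source (leaf t) (just (2 + (n + toℕ j)))
  detour-distance j t = detour j t (λ _ → x∈p∩∁⁅y⁆ ∈⊤) , shortest
    where
    shortest : ∀ k → Walk G (⊤ ∩ ∁ ⁅ segment j ⁆) source (leaf t) k → 2 + (n + toℕ j) ≤ k
    shortest k W = ≤-pred (begin
      3 + (n + toℕ j)                           ≤⟨ detour-lower-bound (x∉p∩∁⁅x⁆ ⊤ (segment j)) W ⟩
      k + leafLevel (⊤ ∩ ∁ ⁅ segment j ⁆) j t  ≡⟨ cong (k +_) (leafLevel-∈ (x∈p∩∁⁅y⁆ ∈⊤ cross≢segment)) ⟩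
      k + 1                                     ≡⟨ +-comm k 1 ⟩
      suc k                                     ∎)
      where open ≤-Reasoning

  preserver-keeps-cross : ∀ H j t → SameDist G (H ∩ ∁ ⁅ segment j ⁆) (⊤ ∩ ∁ ⁅ segment j ⁆) source (leaf t) →
                          cross j t ∈ H
  preserver-keeps-cross H j t same with cross j t ∈? H
  ... | yes c∈H = c∈H
  ... | no  c∉H = ⊥-elim (<-irrefl refl (begin-strict
    2 + (n + toℕ j)                           <⟨ detour-lower-bound (x∉p∩∁⁅x⁆ H (segment j)) W ⟩
    D + leafLevel (H ∩ ∁ ⁅ segment j ⁆) j t  ≡⟨ cong (D +_) (leafLevel-∉ (c∉H ∘ proj₁ ∘ x∈p∩q⁻ H _)) ⟩
    D + 0                                     ≡⟨ +-identityʳ D ⟩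
    D                                         ∎))
    where
    open ≤-Reasoning
    D : ℕ
    D = 2 + (n + toℕ j)
    W : Walk G (H ∩ ∁ ⁅ segment j ⁆) source (leaf t) D
    W = proj₁ (Equivalence.from (same (just D)) (detour-distance j t))

  V≤3*n : 1 ≤ n → V ≤ 3 * n
  V≤3*n 1≤n = begin
    1 + (n + n)        ≤⟨ +-monoˡ-≤ (n + n) 1≤n ⟩
    n + (n + n)        ≡⟨ cong (λ x → n + (n + x)) (+-identityʳ n) ⟨
    n + (n + (n + 0))  ∎
    where open ≤-Reasoning

  n≤V : n ≤ 1 * V
  n≤V = ≤-trans (m≤n+m n (suc n)) (m≤m+n V 0)

  -- Thanks to opposite, the first n pairs are (source , leaf t).
  pair : Fin (suc n) × Fin n → Fin V × Fin V
  pair (q , r) = path (opposite q) , leaf r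

  pair-injective : ∀ x y → SamePair (pair x) (pair y) → x ≡ y
  pair-injective x y (inj₁ (eq₁ , eq₂)) = cong₂ _,_ (opposite-injective (path-injective eq₁)) (leaf-injective eq₂)
  pair-injective x y (inj₂ (eq , _))    = ⊥-elim (path≢leaf eq)

  pairAt : ∀ {p} → p ≤ suc n * n → Fin p → Fin V × Fin V
  pairAt p≤ i = pair (remQuot n (inject≤ i p≤))

  pairs : ∀ {p} → p ≤ suc n * n → Vec (Fin V × Fin V) p
  pairs p≤ = tabulate (pairAt p≤)

  pairs-valid : ∀ {p} (p≤ : p ≤ suc n * n) → PairSet G (pairs p≤)
  pairs-valid p≤ = distinct , injective
    where
    distinct : ∀ i → proj₁ (lookup (pairs p≤) i) ≢ proj₂ (lookup (pairs p≤) i)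
    distinct i rewrite lookup∘tabulate (pairAt p≤) i = path≢leaf
    injective : ∀ i i′ → SamePair (lookup (pairs p≤) i) (lookup (pairs p≤) i′) → i ≡ i′
    injective i i′ rewrite lookup∘tabulate (pairAt p≤) i | lookup∘tabulate (pairAt p≤) i′ =
      inject≤-injective p≤ p≤ i i′ ∘ remQuot-injective n ∘ pair-injective _ _

  lookup-pairs-source : ∀ {p} (p≤ : p ≤ suc n * n) t (t<p : toℕ t < p) →
                        lookup (pairs p≤) (fromℕ< t<p) ≡ (source , leaf t)
  lookup-pairs-source p≤ t t<p = begin
    lookup (pairs p≤) (fromℕ< t<p)             ≡⟨ lookup∘tabulate (pairAt p≤) (fromℕ< t<p) ⟩
    pair (remQuot n (inject≤ (fromℕ< t<p) p≤)) ≡⟨ cong (pair ∘ remQuot n) index≡ ⟩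
    pair (remQuot n (combine {suc n} zero t))  ≡⟨ cong pair (remQuot-combine zero t) ⟩
    (source , leaf t)                          ∎
    where
    open ≡-Reasoning
    index≡ : inject≤ (fromℕ< t<p) p≤ ≡ combine {suc n} zero t
    index≡ = toℕ-injective (trans (toℕ-inject≤ (fromℕ< t<p) p≤)
                           (trans (toℕ-fromℕ< t<p) (sym (toℕ-↑ˡ t (n * n)))))

  preserver-keeps-source-cross : ∀ {p} (p≤ : p ≤ suc n * n) H → OneFTPreserver G (pairs p≤) H →
                                 ∀ j t → toℕ t < p → cross j t ∈ H
  preserver-keeps-source-cross p≤ H preserver j t t<p = preserver-keeps-cross H j t
    (subst (λ st → SameDist G (H ∩ ∁ ⁅ segment j ⁆) (⊤ ∩ ∁ ⁅ segment j ⁆) (proj₁ st) (proj₂ st))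
      (lookup-pairs-source p≤ t t<p)
      (preserver (fromℕ< t<p) ⁅ segment j ⁆ (≤-reflexive (∣⁅x⁆∣≡1 (segment j)))))

  preserver-size : ∀ {p} (p≤ : p ≤ suc n * n) H → OneFTPreserver G (pairs p≤) H → n * (p ⊓ n) ≤ ∣ H ∣
  preserver-size {p} p≤ H preserver = injection⇒≤∣p∣ H kept kept-injective kept∈H
    where
    widen : Fin (p ⊓ n) → Fin n
    widen t = inject≤ t (m⊓n≤n p n)

    kept : Fin (n * (p ⊓ n)) → Fin E
    kept c = cross (quotient {n} (p ⊓ n) c) (widen (remainder {n} (p ⊓ n) c))

    kept-injective : Injective _≡_ _≡_ kept
    kept-injective eq = remQuot-injective (p ⊓ n)
      (cong₂ _,_ (cong proj₁ (cross-injective eq))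
                 (inject≤-injective (m⊓n≤n p n) (m⊓n≤n p n) _ _ (cong proj₂ (cross-injective eq))))

    kept∈H : ∀ c → kept c ∈ H
    kept∈H c = preserver-keeps-source-cross p≤ H preserver _ _
      (subst (_< p) (sym (toℕ-inject≤ t (m⊓n≤n p n))) (<-≤-trans (toℕ<n t) (m⊓n≤m p n)))
      where
      t : Fin (p ⊓ n)
      t = remainder {n} (p ⊓ n) c

theorem8 : Σ ℕ λ a → Σ ℕ λ b → Σ ℕ λ c → (1 ≤ a) × (1 ≤ b) × (1 ≤ c) ×
    ((n p : ℕ) → 1 ≤ p → p ≤ n C 2 →
      Σ WGraph λ G → Σ (Vec (Fin (N G) × Fin (N G)) p) λ P →
        (N G ≤ a * n) × (n ≤ b * N G) × PairSet G P ×
        ((H : EdgeSet G) → OneFTPreserver G P H → (n * p) ⊓ (n * n) ≤ c * ∣ H ∣))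
theorem8 = 3 , 1 , 1 , s≤s z≤n , s≤s z≤n , s≤s z≤n , λ n p 1≤p p≤nC2 →
  let open Construction n
      p≤ = ≤-trans p≤nC2 (≤-trans (nC2≤n*n n) (m≤n+m (n * n) n))
  in G , pairs p≤ , V≤3*n (1≤nC2⇒1≤n (≤-trans 1≤p p≤nC2)) , n≤V , pairs-valid p≤ ,
     λ H preserver → subst₂ _≤_ (*-distribˡ-⊓ n p n) (sym (*-identityˡ ∣ H ∣)) (preserver-size p≤ H preserver)
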